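{- Let $\tilde T$ be a bridging triangulation of the annulus $C_{p,q}$ and let $\underline{i}$ be an admissible ordering of the vertices of $Q_{\tilde T}$. Then the Coxeter transformation $\mathrm{cox}_{\underline{i}}(\tilde T)$ is independent of the choice of the admissible ordering $\underline{i}$.
   Context: $C_{p,q}$ is an annulus with $p>0$ marked points on the outer boundary $\partial$ and $q>0$ on the inner boundary $\partial'$ ($p\ge q$), oriented counter-clockwise. Arcs are taken up to isotopy (curves between marked points, not self-intersecting in the interior, interior disjoint from the boundary, not cutting out an unpunctured monogon or digon); a triangulation is a maximal collection of pairwise non-crossing arcs. An arc is bridging if its endpoints lie on different boundary components; a bridging triangulation consists only of bridging arcs. The quiver $Q_T$ of a triangulation $T$ with arcs $d_1,\dots,d_n$ has vertices $1,\dots,n$ and an arrow $i\to j$ whenever $d_i,d_j$ bound a common triangle and $d_j$ is a clockwise rotation of $d_i$ about their common endpoint. A flip $\mu_d$ replaces the arc $d$ by the other diagonal of the quadrilateral containing it. For a source $i$ of a quiver $Q$, $\sigma_iQ$ is obtained by reversing all arrows incident to $i$; an ordering $i_1,\ldots,i_n$ of the vertices is admissible if each $i_p$ is a source of $\sigma_{i_{p-1}}\cdots\sigma_{i_1}Q$. The Coxeter transformation is $\mathrm{cox}_{\underline{i}}(\tilde T)=\mu_{d_{i_n}}\cdots\mu_{d_{i_1}}\tilde T$. -}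

module Defs where

open import Data.Nat as ℕ using (ℕ)
open import Data.Integer using (ℤ; +_; 0ℤ; _+_; _-_; _*_; _<_)
open import Data.Fin using (Fin; toℕ)
open import Data.List using (List; []; _∷_; allFin)
open import Data.List.Relation.Binary.Permutation.Propositional using (_↭_)
open import Data.Product using (Σ; ∃; ∃-syntax; _×_; _,_)
open import Data.Sum using (_⊎_)
open import Data.Empty using (⊥)
open import Data.Unit using (⊤)
open import Relation.Nullary using (¬_)
open import Relation.Binary.PropositionalEquality using (_≡_; _≢_)

-- Arcs of the annulus C_{p,q}, up to isotopy, via the universal cover.
--
-- Universal cover: the strip ℝ × [0,1].  Outer boundary = bottom line,
-- its marked points are the integers x (x ≡ x mod p gives the same
-- point); inner boundary = top line, marked points the integers y
-- (mod q).  With counter-clockwise orientations of both boundary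
-- circles, marked points increase in the +x direction on both lines,
-- and the covering map is orientation preserving.  Deck transformation:
-- (x , y) ↦ (x + p , y + q).
--
-- Canonical representatives of isotopy classes:
--  * bridge a b : bridging arc whose lifts are (a + kp , b + kq), k ∈ ℤ
--                 (a = outer endpoint, b = lift of the inner endpoint;
--                 b carries the winding number).
--  * outer a ℓ  : arc with both endpoints on the outer boundary, lifts
--                 from a + kp to a + kp + ℓ on the bottom line
--                 (it cuts off the disc containing the ℓ - 1 marked
--                 points a+1,…,a+ℓ-1); valid iff 2 ≤ ℓ ≤ p.
--  * inner b ℓ  : same for the inner boundary; valid iff 2 ≤ ℓ ≤ q.

data Arc (p q : ℕ) : Set where
  bridge : Fin p → ℤ → Arc p q
  outer  : Fin p → ℕ → Arc p q
  inner  : Fin q → ℕ → Arc p q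

-- isotopy classes that are genuine arcs (no digons, no self-crossings)
ValidArc : ∀ {p q} → Arc p q → Set
ValidArc             (bridge a b) = ⊤
ValidArc {p = p}     (outer a ℓ)  = (2 ℕ.≤ ℓ) × (ℓ ℕ.≤ p)
ValidArc {q = q}     (inner b ℓ)  = (2 ℕ.≤ ℓ) × (ℓ ℕ.≤ q)

IsBridging : ∀ {p q} → Arc p q → Set
IsBridging (bridge a b) = ⊤
IsBridging (outer a ℓ)  = ⊥
IsBridging (inner b ℓ)  = ⊥

data Lift : Set where
  lb : ℤ → ℤ → Lift   -- bottom point x to top point y
  lo : ℤ → ℤ → Lift   -- bottom point u to bottom point u' (u < u')
  li : ℤ → ℤ → Lift   -- top point v to top point v' (v < v')

liftAt : ∀ {p q} → Arc p q → ℤ → Lift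
liftAt {p} {q} (bridge a b) k = lb (+ toℕ a + k * + p) (b + k * + q)
liftAt {p} {q} (outer a ℓ)  k = lo (+ toℕ a + k * + p) (+ toℕ a + k * + p + + ℓ)
liftAt {p} {q} (inner b ℓ)  k = li (+ toℕ b + k * + q) (+ toℕ b + k * + q + + ℓ)

-- crossing of two lifts in the interior of the strip
LCross : Lift → Lift → Set
LCross (lb x y) (lb x' y') = (x - x') * (y - y') < 0ℤ
LCross (lb x y) (lo u u')  = (u < x) × (x < u')
LCross (lo u u') (lb x y)  = (u < x) × (x < u')
LCross (lb x y) (li v v')  = (v < y) × (y < v')
LCross (li v v') (lb x y)  = (v < y) × (y < v')
LCross (lo u u') (lo w w') = ((u < w) × (w < u') × (u' < w')) ⊎ ((w < u) × (u < w') × (w' < u'))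
LCross (li u u') (li w w') = ((u < w) × (w < u') × (u' < w')) ⊎ ((w < u) × (u < w') × (w' < u'))
LCross _ _ = ⊥

Cross : ∀ {p q} → Arc p q → Arc p q → Set
Cross A B = ∃[ k ] ∃[ l ] LCross (liftAt A k) (liftAt B l)

-- (Labelled) triangulations: arcs d_1,…,d_n given as T : Fin n → Arc p q

record IsTriangulation {p q n : ℕ} (T : Fin n → Arc p q) : Set where
  field
    valid      : ∀ i → ValidArc (T i)
    distinct   : ∀ i j → T i ≡ T j → i ≡ j
    noncrossing : ∀ i j → ¬ Cross (T i) (T j)
    maximal    : ∀ (A : Arc p q) → ValidArc A → (∀ i → ¬ Cross A (T i)) → ∃[ i ] T i ≡ A

IsBridgingTriangulation : ∀ {p q n} → (Fin n → Arc p q) → Set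
IsBridgingTriangulation T = IsTriangulation T × (∀ i → IsBridging (T i))

SameArcs : ∀ {p q n m} → (Fin n → Arc p q) → (Fin m → Arc p q) → Set
SameArcs T T' = (∀ i → ∃[ j ] T' j ≡ T i) × (∀ j → ∃[ i ] T i ≡ T' j)

-- flip μ_{d_i}: T' replaces the arc d_i by the other diagonal of its
-- quadrilateral, i.e. the unique different arc giving again a triangulation
-- (the new arc keeps the label i)
record Flip {p q n : ℕ} (T : Fin n → Arc p q) (i : Fin n) (T' : Fin n → Arc p q) : Set where
  field
    others  : ∀ j → j ≢ i → T' j ≡ T j
    changed : T' i ≢ T i
    triang  : IsTriangulation T'

-- Flips T (i₁ ∷ … ∷ iₖ) T' : T' = μ_{d_{iₖ}} ⋯ μ_{d_{i₁}} T
data Flips {p q n : ℕ} : (Fin n → Arc p q) → List (Fin n) → (Fin n → Arc p q) → Set where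
  done : ∀ {T} → Flips T [] T
  step : ∀ {T T' T'' i is} → Flip T i T' → Flips T' is T'' → Flips T (i ∷ is) T''

Quiver : ℕ → Set₁
Quiver n = Fin n → Fin n → Set      -- Q i j : there is an arrow i → j

-- Quiver of a bridging triangulation: i → j iff d_i, d_j bound a common
-- triangle and d_j is the clockwise rotation of d_i about their common
-- endpoint.  In the universal cover this means: some lift (x , y) of d_i
-- and the lift (x , y + 1) of d_j  (common outer endpoint), or
-- the lift (x - 1 , y) of d_j (common inner endpoint).
IsLift : ∀ {p q} → Arc p q → ℤ → ℤ → Set
IsLift A x y = ∃[ k ] liftAt A k ≡ lb x y

quiver : ∀ {p q n} → (Fin n → Arc p q) → Quiver n
quiver T i j = ∃[ x ] ∃[ y ] IsLift (T i) x y × (IsLift (T j) x (y + + 1) ⊎ IsLift (T j) (x - + 1) y)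

IsSource : ∀ {n} → Quiver n → Fin n → Set
IsSource Q i = ∀ j → ¬ Q j i

σ : ∀ {n} → Fin n → Quiver n → Quiver n
σ i Q x y = ((x ≡ i ⊎ y ≡ i) × Q y x) ⊎ ((x ≢ i) × (y ≢ i) × Q x y)

IsOrdering : ∀ {n} → List (Fin n) → Set
IsOrdering {n} is = is ↭ allFin n

AdmissibleSeq : ∀ {n} → Quiver n → List (Fin n) → Set
AdmissibleSeq Q []       = ⊤
AdmissibleSeq Q (i ∷ is) = IsSource Q i × AdmissibleSeq (σ i Q) is

Admissible : ∀ {n} → Quiver n → List (Fin n) → Set
Admissible Q is = IsOrdering is × AdmissibleSeq Q is

module Submission where

-- A bridging arc lifts to the universal cover (the strip) as a deck orbit of lattice points (x , y): segments
-- from x on the bottom line to y on the top line. Two bridging arcs cross iff two of their lifts are strictly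
-- opposed (x < x' and y' < y, or the reverse). Maximality of a bridging triangulation makes its lifts a
-- staircase: every lift has a lifted neighbour to its left or below, and one to its right or above. An arrow
-- j → i of Q_T says that d_j has lifts right of or below those of d_i, so at a source i each lift (x , y) of d_i
-- has neighbours at (x - 1 , y) and (x , y + 1), and the flip of d_i is forced to be the rotation
-- (x - 1 , y + 1). Along an admissible ordering the arcs flipped so far are rotated and σ leaves the arrows
-- among the remaining vertices as in Q_T, so every flip is of this kind and cox(T) is the rotation of T,
-- whatever the admissible ordering.

open import Data.Nat as ℕ using (ℕ; NonZero)
open import Data.Integer using (ℤ; +_; -[1+_]; +[1+_]; 0ℤ; _+_; _-_; _*_; -_; _<_; _≤_; +<+; -<+)
open import Data.Integer.Properties
open import Data.Integer.DivMod using (_/ℕ_; n%ℕd<d; a≡a%ℕn+[a/ℕn]*n)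
open import Data.Integer.Tactic.RingSolver using (solve-∀)
open import Algebra.Bundles using (AbelianGroup)
open import Algebra.Properties.Group (AbelianGroup.group +-0-abelianGroup)
  using (∙-cancelʳ; //-rightDividesˡ; //-rightDividesʳ)
open import Data.Fin using (Fin; toℕ; fromℕ<)
open import Data.Fin.Properties using (toℕ<n; toℕ-injective; toℕ-fromℕ<; any?)
import Data.Fin.Properties as Fin
open import Data.Vec.Functional using (updateAt)
open import Data.Vec.Functional.Properties using (updateAt-updates; updateAt-minimal)
open import Data.List using (List; []; _∷_)
open import Data.List.Membership.Propositional using (_∈_; _∉_)
open import Data.List.Membership.Propositional.Properties using (∈-allFin)
open import Data.List.Relation.Unary.Any using (here; there)
import Data.List.Relation.Unary.All as All
open import Data.List.Relation.Unary.AllPairs using (_∷_)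
open import Data.List.Relation.Unary.Unique.Propositional using (Unique)
open import Data.List.Relation.Unary.Unique.Propositional.Properties using (allFin⁺)
open import Data.List.Relation.Binary.Permutation.Propositional using (↭-sym; ↭⇒↭ₛ)
open import Data.List.Relation.Binary.Permutation.Propositional.Properties using (∈-resp-↭)
open import Data.List.Relation.Binary.Permutation.Setoid.Properties using (Unique-resp-↭)
open import Data.Product using (Σ-syntax; ∃-syntax; _×_; _,_; proj₁; proj₂)
open import Data.Sum as Sum using (_⊎_; inj₁; inj₂)
open import Data.Empty using (⊥; ⊥-elim)
open import Function using (_∘_)
open import Relation.Nullary using (¬_; Dec; yes; no)
open import Relation.Nullary.Decidable using (map′; _×-dec_)
open import Relation.Binary.Definitions using (Decidable; tri<; tri≈; tri>)
open import Relation.Binary.PropositionalEquality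
open import Relation.Binary.PropositionalEquality.Properties using (setoid)

open import Defs

i-j+j≡i : ∀ i j → i - j + j ≡ i
i-j+j≡i i j = //-rightDividesˡ j i

i+j-j≡i : ∀ i j → i + j - j ≡ i
i+j-j≡i i j = //-rightDividesʳ j i

SegmentsCross : ℤ → ℤ → ℤ → ℤ → Set
SegmentsCross x y x' y' = (x < x' × y' < y) ⊎ (x' < x × y < y')

i<j⇒i-j<0 : ∀ {i j} → i < j → i - j < 0ℤ
i<j⇒i-j<0 {i} {j} i<j = subst (i - j <_) (+-inverseʳ j) (+-monoˡ-< (- j) i<j)

i-j<0⇒i<j : ∀ {i j} → i - j < 0ℤ → i < j
i-j<0⇒i<j {i} {j} i-j<0 = subst₂ _<_ (i-j+j≡i i j) (+-identityˡ j) (+-monoˡ-< j i-j<0)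

i<j⇒0<j-i : ∀ {i j} → i < j → 0ℤ < j - i
i<j⇒0<j-i {i} {j} i<j = subst (_< j - i) (+-inverseʳ i) (+-monoˡ-< (- i) i<j)

0<i-j⇒j<i : ∀ {i j} → 0ℤ < i - j → j < i
0<i-j⇒j<i {i} {j} 0<i-j = subst₂ _<_ (+-identityˡ j) (i-j+j≡i i j) (+-monoˡ-< j 0<i-j)

*<0⇒opposite-signs : ∀ i j → i * j < 0ℤ → (i < 0ℤ × 0ℤ < j) ⊎ (0ℤ < i × j < 0ℤ)
*<0⇒opposite-signs i (+ 0) ij<0 = ⊥-elim (<-irrefl refl (subst (_< 0ℤ) (*-zeroʳ i) ij<0))
*<0⇒opposite-signs +[1+ m ] -[1+ n ] _ = inj₂ (+<+ (ℕ.s≤s ℕ.z≤n) , -<+)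
*<0⇒opposite-signs -[1+ m ] +[1+ n ] _ = inj₁ (-<+ , +<+ (ℕ.s≤s ℕ.z≤n))
*<0⇒opposite-signs (+ 0) +[1+ n ] (+<+ ())
*<0⇒opposite-signs (+ 0) -[1+ n ] (+<+ ())
*<0⇒opposite-signs +[1+ m ] +[1+ n ] (+<+ ())
*<0⇒opposite-signs -[1+ m ] -[1+ n ] (+<+ ())

opposite-signs⇒*<0 : ∀ {i j} → (i < 0ℤ × 0ℤ < j) ⊎ (0ℤ < i × j < 0ℤ) → i * j < 0ℤ
opposite-signs⇒*<0 { -[1+ m ]} {+[1+ n ]} _ = -<+
opposite-signs⇒*<0 {+[1+ m ]} { -[1+ n ]} _ = -<+
opposite-signs⇒*<0 {+ _} (inj₁ (+<+ () , _))
opposite-signs⇒*<0 { -[1+ _ ]} {+ 0} (inj₁ (_ , +<+ ()))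
opposite-signs⇒*<0 { -[1+ _ ]} { -[1+ _ ]} (inj₁ (_ , ()))
opposite-signs⇒*<0 {+ 0} (inj₂ (+<+ () , _))
opposite-signs⇒*<0 { -[1+ _ ]} (inj₂ (() , _))
opposite-signs⇒*<0 {+[1+ _ ]} {+ _} (inj₂ (_ , +<+ ()))

*<0⇒SegmentsCross : ∀ {x y x' y'} → (x - x') * (y - y') < 0ℤ → SegmentsCross x y x' y'
*<0⇒SegmentsCross {x} {y} {x'} {y'} h with *<0⇒opposite-signs (x - x') (y - y') h
... | inj₁ (dx<0 , 0<dy) = inj₁ (i-j<0⇒i<j dx<0 , 0<i-j⇒j<i 0<dy)
... | inj₂ (0<dx , dy<0) = inj₂ (0<i-j⇒j<i 0<dx , i-j<0⇒i<j dy<0)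

SegmentsCross⇒*<0 : ∀ {x y x' y'} → SegmentsCross x y x' y' → (x - x') * (y - y') < 0ℤ
SegmentsCross⇒*<0 (inj₁ (x<x' , y'<y)) = opposite-signs⇒*<0 (inj₁ (i<j⇒i-j<0 x<x' , i<j⇒0<j-i y'<y))
SegmentsCross⇒*<0 (inj₂ (x'<x , y<y')) = opposite-signs⇒*<0 (inj₂ (i<j⇒0<j-i x'<x , i<j⇒i-j<0 y<y'))

SegmentsCross-sym : ∀ {x y x' y'} → SegmentsCross x y x' y' → SegmentsCross x' y' x y
SegmentsCross-sym (inj₁ c) = inj₂ c
SegmentsCross-sym (inj₂ c) = inj₁ c

SegmentsCross-+ : ∀ {x y x' y'} c d → SegmentsCross x y x' y' →
                  SegmentsCross (x + c) (y + d) (x' + c) (y' + d)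
SegmentsCross-+ c d (inj₁ (x<x' , y'<y)) = inj₁ (+-monoˡ-< c x<x' , +-monoˡ-< d y'<y)
SegmentsCross-+ c d (inj₂ (x'<x , y<y')) = inj₂ (+-monoˡ-< c x'<x , +-monoˡ-< d y<y')

SegmentsCross-neg : ∀ {x y x' y'} → SegmentsCross x y x' y' → SegmentsCross (- x) (- y) (- x') (- y')
SegmentsCross-neg (inj₁ (x<x' , y'<y)) = inj₂ (neg-mono-< x<x' , neg-mono-< y'<y)
SegmentsCross-neg (inj₂ (x'<x , y<y')) = inj₁ (neg-mono-< x'<x , neg-mono-< y<y')

i<i+1 : ∀ i → i < i + + 1
i<i+1 i = subst (_< i + + 1) (+-identityʳ i) (+-monoʳ-< i (+<+ (ℕ.s≤s ℕ.z≤n)))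

i-1<i : ∀ i → i - + 1 < i
i-1<i i = subst (i - + 1 <_) (+-identityʳ i) (+-monoʳ-< i -<+)

i<j⇒i+1≤j : ∀ {i j} → i < j → i + + 1 ≤ j
i<j⇒i+1≤j {i} {j} i<j = subst (_≤ j) (+-comm (+ 1) i) (i<j⇒suc[i]≤j i<j)

i-1<j⇒i≤j : ∀ {i j} → i - + 1 < j → i ≤ j
i-1<j⇒i≤j {i} {j} i-1<j = subst (_≤ j) (i-j+j≡i i (+ 1)) (i<j⇒i+1≤j i-1<j)

i<j⇒i≤j-1 : ∀ {i j} → i < j → i ≤ j - + 1
i<j⇒i≤j-1 {i} {j} i<j = subst (i ≤_) (+-comm (- + 1) j) (i<j⇒i≤pred[j] i<j)

crosses-left-only : ∀ {x y x' y'} → SegmentsCross (x - + 1) y x' y' → ¬ SegmentsCross x y x' y' →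
                    x' ≡ x × y' < y
crosses-left-only (inj₁ (x-1<x' , y'<y)) ¬c =
  sym (≤∧≮⇒≡ (i-1<j⇒i≤j x-1<x') (λ x<x' → ¬c (inj₁ (x<x' , y'<y)))) , y'<y
crosses-left-only {x} (inj₂ (x'<x-1 , y<y')) ¬c = ⊥-elim (¬c (inj₂ (<-trans x'<x-1 (i-1<i x) , y<y')))

no-crossing-below-only : ∀ {x y y' x₃ y₃} → y' < y → SegmentsCross x (y - + 1) x₃ y₃ →
                         ¬ SegmentsCross x y x₃ y₃ → ¬ SegmentsCross x y' x₃ y₃ → ⊥
no-crossing-below-only {y = y} _ (inj₁ (x<x₃ , y₃<y-1)) ¬c _ = ¬c (inj₁ (x<x₃ , <-trans y₃<y-1 (i-1<i y)))
no-crossing-below-only y'<y (inj₂ (x₃<x , y-1<y₃)) ¬c ¬c'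
  with ≤∧≮⇒≡ (i-1<j⇒i≤j y-1<y₃) (λ y<y₃ → ¬c (inj₂ (x₃<x , y<y₃)))
... | refl = ¬c' (inj₂ (x₃<x , y'<y))

crosses-corner-only : ∀ {x y x' y'} → SegmentsCross x' y' x y →
                      ¬ SegmentsCross x' y' (x - + 1) y → ¬ SegmentsCross x' y' x (y + + 1) →
                      x' ≡ x - + 1 × y' ≡ y + + 1
crosses-corner-only (inj₁ (x'<x , y<y')) ¬c₁ ¬c₂ =
  ≤∧≮⇒≡ (i<j⇒i≤j-1 x'<x) (λ x'<x-1 → ¬c₁ (inj₁ (x'<x-1 , y<y'))) ,
  sym (≤∧≮⇒≡ (i<j⇒i+1≤j y<y') (λ y+1<y' → ¬c₂ (inj₁ (x'<x , y+1<y'))))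
crosses-corner-only {x} (inj₂ (x<x' , y'<y)) ¬c₁ _ = ⊥-elim (¬c₁ (inj₂ (<-trans (i-1<i x) x<x' , y'<y)))

crosses-diagonal-only : ∀ {x y x' y'} → SegmentsCross x y x' y' →
                        ¬ SegmentsCross x' y' x (y - + 1) → ¬ SegmentsCross x' y' (x + + 1) y →
                        x' ≡ x + + 1 × y' ≡ y - + 1
crosses-diagonal-only (inj₁ (x<x' , y'<y)) ¬c₁ ¬c₂ =
  sym (≤∧≮⇒≡ (i<j⇒i+1≤j x<x') (λ x+1<x' → ¬c₂ (inj₂ (x+1<x' , y'<y)))) ,
  ≤∧≮⇒≡ (i<j⇒i≤j-1 y'<y) (λ y'<y-1 → ¬c₁ (inj₂ (x<x' , y'<y-1)))
crosses-diagonal-only {y = y} (inj₂ (x'<x , y<y')) ¬c₁ _ =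
  ⊥-elim (¬c₁ (inj₁ (x'<x , <-trans (i-1<i y) y<y')))

module _ (S : ℤ → ℤ → Set) where

  NonCrossing : Set
  NonCrossing = ∀ {x y x' y'} → S x y → S x' y' → ¬ SegmentsCross x y x' y'

  Saturated : Set
  Saturated = ∀ x y → (∀ {x' y'} → S x' y' → ¬ SegmentsCross x y x' y') → S x y

module _ {S : ℤ → ℤ → Set} (noncrossing : NonCrossing S) (saturated : Saturated S) (S? : Decidable S) where

  -- A point of S crossing (x - 1 , y) but not (x , y) is some (x , y') with y' < y, and nothing crosses
  -- (x , y - 1) without crossing (x , y) or (x , y'): so (x , y - 1) is in S.
  left-or-below : ∀ {x y} → S x y → S (x - + 1) y ⊎ S x (y - + 1)
  left-or-below {x} {y} sxy with S? x (y - + 1)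
  ... | yes below = inj₂ below
  ... | no ¬below = inj₁ (saturated (x - + 1) y λ s' c → ¬below (below-from s' c))
    where
      below-from : ∀ {x' y'} → S x' y' → SegmentsCross (x - + 1) y x' y' → S x (y - + 1)
      below-from s' c with crosses-left-only c (noncrossing sxy s')
      ... | refl , y'<y = saturated x (y - + 1) λ s₃ c₃ →
        no-crossing-below-only y'<y c₃ (noncrossing sxy s₃) (noncrossing s' s₃)

-- The point reflection of the strip preserves crossings and exchanges "left or below" with "right or above".
Reflected : (ℤ → ℤ → Set) → ℤ → ℤ → Set
Reflected S x y = S (- x) (- y)

NonCrossing-Reflected : ∀ {S} → NonCrossing S → NonCrossing (Reflected S)
NonCrossing-Reflected noncrossing s s' c = noncrossing s s' (SegmentsCross-neg c)

Saturated-Reflected : ∀ {S} → Saturated S → Saturated (Reflected S)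
Saturated-Reflected {S} saturated x y free = saturated (- x) (- y) λ {x'} {y'} s' c →
  free (subst₂ S (sym (neg-involutive x')) (sym (neg-involutive y')) s')
       (subst₂ (λ u v → SegmentsCross u v (- x') (- y')) (neg-involutive x) (neg-involutive y)
               (SegmentsCross-neg c))

-[-i-1]≡i+1 : ∀ i → - (- i - + 1) ≡ i + + 1
-[-i-1]≡i+1 = solve-∀

right-or-above : ∀ {S : ℤ → ℤ → Set} → NonCrossing S → Saturated S → Decidable S →
                 ∀ {x y} → S x y → S (x + + 1) y ⊎ S x (y + + 1)
right-or-above {S} noncrossing saturated S? {x} {y} sxy =
  Sum.map (subst₂ S (-[-i-1]≡i+1 x) (neg-involutive y)) (subst₂ S (neg-involutive x) (-[-i-1]≡i+1 y))
    (left-or-below (NonCrossing-Reflected noncrossing) (Saturated-Reflected saturated)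
                   (λ u v → S? (- u) (- v)) (subst₂ S (sym (neg-involutive x)) (sym (neg-involutive y)) sxy))

digit-< : ∀ {p} (a a' : Fin p) {k k'} → k < k' → + toℕ a + k * + p < + toℕ a' + k' * + p
digit-< {p} a a' {k} {k'} k<k' = begin-strict
  + toℕ a + k * + p    <⟨ +-monoˡ-< (k * + p) (+<+ (toℕ<n a)) ⟩
  + p + k * + p        ≡⟨ suc-* k (+ p) ⟨
  (+ 1 + k) * + p      ≤⟨ *-monoʳ-≤-nonNeg (+ p) (i<j⇒suc[i]≤j k<k') ⟩
  k' * + p             ≤⟨ i≤j+i (k' * + p) (+ toℕ a') ⟩
  + toℕ a' + k' * + p  ∎
  where open ≤-Reasoning

digit-injective : ∀ {p} {a a' : Fin p} {k k'} → + toℕ a + k * + p ≡ + toℕ a' + k' * + p →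
                  a ≡ a' × k ≡ k'
digit-injective {p} {a} {a'} {k} {k'} eq with <-cmp k k'
... | tri< k<k' _ _ = ⊥-elim (<-irrefl eq (digit-< a a' k<k'))
... | tri> _ _ k>k' = ⊥-elim (<-irrefl (sym eq) (digit-< a' a k>k'))
... | tri≈ _ refl _ = toℕ-injective (+-injective (∙-cancelʳ (k * + p) _ _ eq)) , refl

lb-injective : ∀ {x y x' y'} → lb x y ≡ lb x' y' → x ≡ x' × y ≡ y'
lb-injective refl = refl , refl

module _ {p q : ℕ} where

  IsLift-bridge : ∀ a b → IsLift {p} {q} (bridge a b) (+ toℕ a) b
  IsLift-bridge a b = 0ℤ , cong₂ lb (e (+ toℕ a) (+ p)) (e b (+ q))
    where e : ∀ a P → a + 0ℤ * P ≡ a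
          e = solve-∀

  IsLift⇒IsBridging : ∀ {A : Arc p q} {x y} → IsLift A x y → IsBridging A
  IsLift⇒IsBridging {bridge _ _} _ = _
  IsLift⇒IsBridging {outer _ _} (_ , ())
  IsLift⇒IsBridging {inner _ _} (_ , ())

  IsBridging⇒ValidArc : ∀ {A : Arc p q} → IsBridging A → ValidArc A
  IsBridging⇒ValidArc {bridge _ _} _ = _

  liftAt-bridging : ∀ {A : Arc p q} → IsBridging A → ∀ k → ∃[ x ] ∃[ y ] liftAt A k ≡ lb x y
  liftAt-bridging {bridge _ _} _ k = _ , _ , refl

  lifts-differ-by-deck : ∀ {A : Arc p q} {x y x' y'} → IsLift A x y → IsLift A x' y' →
                         ∃[ m ] (x' ≡ x + m * + p × y' ≡ y + m * + q)
  lifts-differ-by-deck {bridge a b} (k , refl) (k' , refl) = k' - k , e (+ toℕ a) k k' (+ p) , e b k k' (+ q)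
    where e : ∀ a k k' P → a + k' * P ≡ a + k * P + (k' - k) * P
          e = solve-∀
  lifts-differ-by-deck {outer _ _} (_ , ())
  lifts-differ-by-deck {inner _ _} (_ , ())

  IsLift-deck : ∀ {A : Arc p q} {x y} → IsLift A x y → ∀ m → IsLift A (x + m * + p) (y + m * + q)
  IsLift-deck {bridge a b} (k , refl) m = k + m , cong₂ lb (e (+ toℕ a) k m (+ p)) (e b k m (+ q))
    where e : ∀ a k m P → a + (k + m) * P ≡ a + k * P + m * P
          e = solve-∀
  IsLift-deck {outer _ _} (_ , ())
  IsLift-deck {inner _ _} (_ , ())

  IsLift-injective : ∀ {A B : Arc p q} {x y} → IsLift A x y → IsLift B x y → A ≡ B
  IsLift-injective {bridge a b} {bridge a' b'} (k , refl) (k' , eq) with lb-injective eq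
  ... | ex , ey with digit-injective {p} {a'} {a} {k'} {k} ex
  ...   | refl , refl = cong (bridge a) (sym (∙-cancelʳ (k * + q) b' b ey))
  IsLift-injective {bridge _ _} {outer _ _} _ (_ , ())
  IsLift-injective {bridge _ _} {inner _ _} _ (_ , ())
  IsLift-injective {outer _ _} (_ , ())
  IsLift-injective {inner _ _} (_ , ())

  SegmentsCross⇒Cross : ∀ {A B : Arc p q} {x y x' y'} → IsLift A x y → IsLift B x' y' →
                        SegmentsCross x y x' y' → Cross A B
  SegmentsCross⇒Cross (k , eA) (l , eB) c = k , l , subst₂ LCross (sym eA) (sym eB) (SegmentsCross⇒*<0 c)

  crossing-lifts : ∀ {A B : Arc p q} → IsBridging A → IsBridging B → Cross A B →
                   ∃[ x ] ∃[ y ] ∃[ x' ] ∃[ y' ]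
                     (IsLift A x y × IsLift B x' y' × SegmentsCross x y x' y')
  crossing-lifts {bridge _ _} {bridge _ _} _ _ (k , l , h) =
    _ , _ , _ , _ , (k , refl) , (l , refl) , *<0⇒SegmentsCross h

  Cross⇒SegmentsCross : ∀ {A B : Arc p q} {x y} → IsLift A x y → IsBridging B → Cross A B →
                        ∃[ x' ] ∃[ y' ] (IsLift B x' y' × SegmentsCross x y x' y')
  Cross⇒SegmentsCross lA bB c with crossing-lifts (IsLift⇒IsBridging lA) bB c
  ... | _ , _ , x₂ , y₂ , lA₁ , lB₂ , c₁₂ with lifts-differ-by-deck lA₁ lA
  ... | m , refl , refl =
    x₂ + m * + p , y₂ + m * + q , IsLift-deck lB₂ m , SegmentsCross-+ (m * + p) (m * + q) c₁₂

  Cross-sym : ∀ {A B : Arc p q} → IsBridging A → IsBridging B → Cross A B → Cross B A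
  Cross-sym bA bB c with crossing-lifts bA bB c
  ... | _ , _ , _ , _ , lA , lB , c' = SegmentsCross⇒Cross lB lA (SegmentsCross-sym c')

  ¬Cross-resp-≡ : ∀ {A A' B B' : Arc p q} → A ≡ A' → B ≡ B' → ¬ Cross A B → ¬ Cross A' B'
  ¬Cross-resp-≡ refl refl ¬c = ¬c

  ≟-bridging : ∀ (A B : Arc p q) → IsBridging B → Dec (A ≡ B)
  ≟-bridging (bridge a b) (bridge a' b') _ =
    map′ (λ { (refl , refl) → refl }) (λ { refl → refl , refl }) ((a Fin.≟ a') ×-dec (b ≟ b'))
  ≟-bridging (outer _ _) (bridge _ _) _ = no λ ()
  ≟-bridging (inner _ _) (bridge _ _) _ = no λ ()

module _ {p q : ℕ} .{{_ : NonZero p}} where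

  bridgeThrough : ℤ → ℤ → Arc p q
  bridgeThrough x y = bridge (fromℕ< (n%ℕd<d x p)) (y - (x /ℕ p) * + q)

  IsLift-bridgeThrough : ∀ x y → IsLift (bridgeThrough x y) x y
  IsLift-bridgeThrough x y = x /ℕ p , cong₂ lb ex (i-j+j≡i y ((x /ℕ p) * + q))
    where
      ex : + toℕ (fromℕ< (n%ℕd<d x p)) + (x /ℕ p) * + p ≡ x
      ex = trans (cong (λ r → + r + (x /ℕ p) * + p) (toℕ-fromℕ< (n%ℕd<d x p)))
                 (sym (a≡a%ℕn+[a/ℕn]*n x p))

  IsLift? : ∀ (A : Arc p q) x y → Dec (IsLift A x y)
  IsLift? A x y =
    map′ (λ A≡B → subst (λ B → IsLift B x y) (sym A≡B) (IsLift-bridgeThrough x y))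
         (λ lA → IsLift-injective {A = A} {B = bridgeThrough x y} lA (IsLift-bridgeThrough x y))
         (≟-bridging A (bridgeThrough x y) _)

  -- Only meaningful on bridging arcs; the others are left unchanged.
  rotate : Arc p q → Arc p q
  rotate (bridge a b) = bridgeThrough (+ toℕ a - + 1) (b + + 1)
  rotate A            = A

  IsBridging-rotate : ∀ {A : Arc p q} → IsBridging A → IsBridging (rotate A)
  IsBridging-rotate {bridge _ _} _ = _

  IsLift-rotate : ∀ {A : Arc p q} {x y} → IsLift A x y → IsLift (rotate A) (x - + 1) (y + + 1)
  IsLift-rotate {bridge a b} lA with lifts-differ-by-deck {A = bridge a b} (IsLift-bridge a b) lA
  ... | m , refl , refl =
    subst₂ (IsLift (rotate (bridge a b))) (e (+ toℕ a) (m * + p) (- + 1)) (e b (m * + q) (+ 1))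
           (IsLift-deck {A = rotate (bridge a b)} (IsLift-bridgeThrough (+ toℕ a - + 1) (b + + 1)) m)
    where e : ∀ a z c → a + c + z ≡ a + z + c
          e = solve-∀
  IsLift-rotate {outer _ _} (_ , ())
  IsLift-rotate {inner _ _} (_ , ())

  IsLift-rotate⁻ : ∀ {A : Arc p q} {x y} → IsBridging A → IsLift (rotate A) x y →
                   IsLift A (x + + 1) (y - + 1)
  IsLift-rotate⁻ {bridge a b} _ lA
    with lifts-differ-by-deck {A = rotate (bridge a b)} (IsLift-bridgeThrough (+ toℕ a - + 1) (b + + 1)) lA
  ... | m , refl , refl =
    subst₂ (IsLift (bridge a b)) (e (+ toℕ a) (m * + p) (- + 1)) (e b (m * + q) (+ 1))
           (IsLift-deck {A = bridge a b} (IsLift-bridge a b) m)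
    where e : ∀ a z c → a + z ≡ a + c + z - c
          e = solve-∀

  Lifts : ∀ {n} → (Fin n → Arc p q) → ℤ → ℤ → Set
  Lifts T x y = ∃[ j ] IsLift (T j) x y

  Lifts? : ∀ {n} (T : Fin n → Arc p q) → Decidable (Lifts T)
  Lifts? T x y = any? λ j → IsLift? (T j) x y

  module _ {n} {T : Fin n → Arc p q} (tri : IsTriangulation T) (bridging : ∀ j → IsBridging (T j)) where
    open IsTriangulation tri

    NonCrossing-Lifts : NonCrossing (Lifts T)
    NonCrossing-Lifts (j , lj) (k , lk) c = noncrossing j k (SegmentsCross⇒Cross lj lk c)

    Saturated-Lifts : Saturated (Lifts T)
    Saturated-Lifts x y free with maximal (bridgeThrough x y) _ crossing-free
      where
        crossing-free : ∀ j → ¬ Cross (bridgeThrough x y) (T j)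
        crossing-free j c
          with Cross⇒SegmentsCross {A = bridgeThrough x y} (IsLift-bridgeThrough x y) (bridging j) c
        ... | _ , _ , lj , c' = free (j , lj) c'
    ... | j , Tj≡B = j , subst (λ B → IsLift B x y) (sym Tj≡B) (IsLift-bridgeThrough x y)

  -- d_i is the diagonal of the quadrilateral with sides at (x - 1 , y) and (x , y + 1); the other diagonal is
  -- (x - 1 , y + 1), a lift of the rotation of d_i.
  Corner : ∀ {n} → (Fin n → Arc p q) → Fin n → Set
  Corner T i = ∀ {x y} → IsLift (T i) x y →
    (∃[ a ] (a ≢ i × IsLift (T a) (x - + 1) y)) × (∃[ b ] (b ≢ i × IsLift (T b) x (y + + 1)))

  module FlipAt {n} {T : Fin n → Arc p q} (tri : IsTriangulation T) (bridging : ∀ j → IsBridging (T j))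
                (i : Fin n) (corner : Corner T i) where
    open IsTriangulation tri

    crossing-only-dᵢ⇒rotation : ∀ A → Cross A (T i) → (∀ j → j ≢ i → ¬ Cross A (T j)) →
                                A ≡ rotate (T i)
    crossing-only-dᵢ⇒rotation A (k , l , h) alone with liftAt-bridging (bridging i) l
    ... | x , y , eq with corner (l , eq)
    ... | (a , a≢i , la) , (b , b≢i , lb') =
      by-kind A (subst (LCross (liftAt A k)) eq h) (alone a a≢i) (alone b b≢i)
      where
        by-kind : ∀ A → LCross (liftAt A k) (lb x y) → ¬ Cross A (T a) → ¬ Cross A (T b) →
                  A ≡ rotate (T i)
        by-kind (bridge a₀ b₀) c ¬ca ¬cb
          with crosses-corner-only (*<0⇒SegmentsCross c)
                 (λ c' → ¬ca (SegmentsCross⇒Cross {A = bridge a₀ b₀} (k , refl) la c'))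
                 (λ c' → ¬cb (SegmentsCross⇒Cross {A = bridge a₀ b₀} (k , refl) lb' c'))
        ... | ex , ey =
          IsLift-injective {A = bridge a₀ b₀} (k , cong₂ lb ex ey) (IsLift-rotate {A = T i} (l , eq))
        -- An arc with both ends on one boundary crosses the lift (x , y) by separating its end on that
        -- boundary, which it shares with (x , y + 1) (outer) or with (x - 1 , y) (inner).
        by-kind A@(outer _ _) c _ ¬cb =
          ⊥-elim (¬cb (k , proj₁ lb' , subst (LCross (liftAt A k)) (sym (proj₂ lb')) c))
        by-kind A@(inner _ _) c ¬ca _ =
          ⊥-elim (¬ca (k , proj₁ la , subst (LCross (liftAt A k)) (sym (proj₂ la)) c))

    rotation-crosses-dᵢ : Cross (rotate (T i)) (T i)
    rotation-crosses-dᵢ with liftAt-bridging (bridging i) 0ℤ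
    ... | x , y , eq = SegmentsCross⇒Cross {A = rotate (T i)} (IsLift-rotate {A = T i} (0ℤ , eq)) (0ℤ , eq)
                         (inj₁ (i-1<i x , i<i+1 y))

    rotation-crosses-only-dᵢ : ∀ k → k ≢ i → ¬ Cross (rotate (T i)) (T k)
    rotation-crosses-only-dᵢ k k≢i c with crossing-lifts (IsBridging-rotate (bridging i)) (bridging k) c
    ... | u , v , _ , _ , lu , lk , c' with corner (IsLift-rotate⁻ (bridging i) lu)
    ... | (a , _ , la) , (b , _ , lb')
      with crosses-diagonal-only c'
             (λ c'' → noncrossing k a (SegmentsCross⇒Cross lk la' c''))
             (λ c'' → noncrossing k b (SegmentsCross⇒Cross lk lb'' c''))
      where
        la' : IsLift (T a) u (v - + 1)
        la' = subst (λ x → IsLift (T a) x (v - + 1)) (i+j-j≡i u (+ 1)) la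
        lb'' : IsLift (T b) (u + + 1) v
        lb'' = subst (IsLift (T b) (u + + 1)) (i-j+j≡i v (+ 1)) lb'
    ... | refl , refl = k≢i (distinct k i (IsLift-injective {A = T k} lk (IsLift-rotate⁻ (bridging i) lu)))

    rotation-self-noncrossing : ¬ Cross (rotate (T i)) (rotate (T i))
    rotation-self-noncrossing c
      with crossing-lifts (IsBridging-rotate (bridging i)) (IsBridging-rotate (bridging i)) c
    ... | _ , _ , _ , _ , l , l' , c' =
      noncrossing i i (SegmentsCross⇒Cross (IsLift-rotate⁻ (bridging i) l) (IsLift-rotate⁻ (bridging i) l')
                                           (SegmentsCross-+ (+ 1) (- + 1) c'))

    rotation≢ : ∀ k → k ≢ i → rotate (T i) ≢ T k
    rotation≢ k k≢i eq = noncrossing k i (subst (λ A → Cross A (T i)) eq rotation-crosses-dᵢ)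

    avoids-rest⇒avoids-all : ∀ A → A ≢ rotate (T i) → (∀ j → j ≢ i → ¬ Cross A (T j)) →
                             ∀ j → ¬ Cross A (T j)
    avoids-rest⇒avoids-all A A≢rot avoids-rest j with j Fin.≟ i
    ... | yes refl = λ c → A≢rot (crossing-only-dᵢ⇒rotation A c avoids-rest)
    ... | no j≢i   = avoids-rest j j≢i

    flipped : Fin n → Arc p q
    flipped = updateAt T i rotate

    flipped-view : ∀ j → (j ≡ i × flipped j ≡ rotate (T i)) ⊎ (j ≢ i × flipped j ≡ T j)
    flipped-view j with j Fin.≟ i
    ... | yes refl = inj₁ (refl , updateAt-updates i T)
    ... | no j≢i   = inj₂ (j≢i , updateAt-minimal j i T j≢i)

    flipped-bridging : ∀ j → IsBridging (flipped j)
    flipped-bridging j with flipped-view j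
    ... | inj₁ (_ , e) = subst IsBridging (sym e) (IsBridging-rotate (bridging i))
    ... | inj₂ (_ , e) = subst IsBridging (sym e) (bridging j)

    flipped-distinct : ∀ j k → flipped j ≡ flipped k → j ≡ k
    flipped-distinct j k e with flipped-view j | flipped-view k
    ... | inj₁ (refl , _)  | inj₁ (refl , _)  = refl
    ... | inj₁ (refl , ej) | inj₂ (k≢i , ek) = ⊥-elim (rotation≢ k k≢i (trans (sym ej) (trans e ek)))
    ... | inj₂ (j≢i , ej) | inj₁ (refl , ek) = ⊥-elim (rotation≢ j j≢i (trans (sym ek) (trans (sym e) ej)))
    ... | inj₂ (_ , ej)   | inj₂ (_ , ek)   = distinct j k (trans (sym ej) (trans e ek))

    flipped-noncrossing : ∀ j k → ¬ Cross (flipped j) (flipped k)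
    flipped-noncrossing j k with flipped-view j | flipped-view k
    ... | inj₁ (_ , ej)   | inj₁ (_ , ek)   = ¬Cross-resp-≡ (sym ej) (sym ek) rotation-self-noncrossing
    ... | inj₁ (_ , ej)   | inj₂ (k≢i , ek) = ¬Cross-resp-≡ (sym ej) (sym ek)
      (rotation-crosses-only-dᵢ k k≢i)
    ... | inj₂ (j≢i , ej) | inj₁ (_ , ek)   = ¬Cross-resp-≡ (sym ej) (sym ek)
      (rotation-crosses-only-dᵢ j j≢i ∘ Cross-sym (bridging j) (IsBridging-rotate (bridging i)))
    ... | inj₂ (_ , ej)   | inj₂ (_ , ek)   = ¬Cross-resp-≡ (sym ej) (sym ek) (noncrossing j k)

    flipped-maximal : ∀ A → ValidArc A → (∀ j → ¬ Cross A (flipped j)) → ∃[ j ] flipped j ≡ A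
    flipped-maximal A vA free with ≟-bridging A (rotate (T i)) (IsBridging-rotate (bridging i))
    ... | yes refl = i , updateAt-updates i T
    ... | no A≢rot with maximal A vA (avoids-rest⇒avoids-all A A≢rot avoids-rest)
      where
        avoids-rest : ∀ j → j ≢ i → ¬ Cross A (T j)
        avoids-rest j j≢i = ¬Cross-resp-≡ refl (updateAt-minimal j i T j≢i) (free j)
    ...   | k , Tk≡A with flipped-view k
    ...     | inj₁ (refl , e) = ⊥-elim (¬Cross-resp-≡ (sym Tk≡A) e (free i)
                                  (Cross-sym (IsBridging-rotate (bridging i)) (bridging i) rotation-crosses-dᵢ))
    ...     | inj₂ (_ , e)    = k , trans e Tk≡A

    flip : Flip T i flipped
    flip = record
      { others  = λ j j≢i → updateAt-minimal j i T j≢i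
      ; changed = λ e → noncrossing i i
          (subst (λ A → Cross A (T i)) (trans (sym (updateAt-updates i T)) e) rotation-crosses-dᵢ)
      ; triang  = record
        { valid       = λ j → IsBridging⇒ValidArc (flipped-bridging j)
        ; distinct    = flipped-distinct
        ; noncrossing = flipped-noncrossing
        ; maximal     = flipped-maximal
        }
      }

    Flip⇒rotation : ∀ {T'} → Flip T i T' → T' i ≡ rotate (T i)
    Flip⇒rotation {T'} f with ≟-bridging (T' i) (rotate (T i)) (IsBridging-rotate (bridging i))
    ... | yes eq = eq
    ... | no T'i≢rot with maximal (T' i) (valid' i) (avoids-rest⇒avoids-all (T' i) T'i≢rot avoids-rest)
      where
        open Flip f using (others; triang)
        open IsTriangulation triang using () renaming (valid to valid'; noncrossing to noncrossing')
        avoids-rest : ∀ j → j ≢ i → ¬ Cross (T' i) (T j)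
        avoids-rest j j≢i = ¬Cross-resp-≡ refl (others j j≢i) (noncrossing' i j)
    ...   | k , Tk≡T'i with k Fin.≟ i
    ...     | yes refl = ⊥-elim (Flip.changed f (sym Tk≡T'i))
    ...     | no k≢i   = ⊥-elim (k≢i (distinct' k i (trans (Flip.others f k k≢i) Tk≡T'i)))
      where open IsTriangulation (Flip.triang f) using () renaming (distinct to distinct')

  module Coxeter {n} {T : Fin n → Arc p q} (tri : IsTriangulation T) (bridging : ∀ j → IsBridging (T j)) where

    RotatedExactly : List (Fin n) → (Fin n → Arc p q) → Set
    RotatedExactly rs T' = ∀ j → (j ∈ rs × T' j ≡ rotate (T j)) ⊎ (j ∉ rs × T' j ≡ T j)

    KeepsArrows : List (Fin n) → Quiver n → Set
    KeepsArrows rs Q = ∀ a b → a ∉ rs → b ∉ rs → quiver T a b → Q a b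

    RotatedExactly-bridging : ∀ {rs T'} → RotatedExactly rs T' → ∀ j → IsBridging (T' j)
    RotatedExactly-bridging rotated j with rotated j
    ... | inj₁ (_ , e) = subst IsBridging (sym e) (IsBridging-rotate (bridging j))
    ... | inj₂ (_ , e) = subst IsBridging (sym e) (bridging j)

    RotatedExactly-fresh : ∀ {rs T' j} → RotatedExactly rs T' → j ∉ rs → T' j ≡ T j
    RotatedExactly-fresh {j = j} rotated j∉rs with rotated j
    ... | inj₁ (j∈rs , _) = ⊥-elim (j∉rs j∈rs)
    ... | inj₂ (_ , e)    = e

    module AtSource {rs T' Q i} (tri' : IsTriangulation T') (rotated : RotatedExactly rs T')
                    (keeps : KeepsArrows rs Q) (i∉rs : i ∉ rs) (source : IsSource Q i) where

      bridging' : ∀ j → IsBridging (T' j)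
      bridging' = RotatedExactly-bridging rotated

      no-arrow-in : ∀ {j} → j ∉ rs → quiver T j i → ⊥
      no-arrow-in {j} j∉rs arrow = source j (keeps j i j∉rs i∉rs arrow)

      lift-Tᵢ : ∀ {x y} → IsLift (T' i) x y → IsLift (T i) x y
      lift-Tᵢ = subst (λ A → IsLift A _ _) (RotatedExactly-fresh rotated i∉rs)

      lift-T : ∀ {j x y} → IsLift (T' j) x y →
               (j ∈ rs × IsLift (T j) (x + + 1) (y - + 1)) ⊎ (j ∉ rs × IsLift (T j) x y)
      lift-T {j} lj with rotated j
      ... | inj₁ (j∈rs , e) = inj₁ (j∈rs , IsLift-rotate⁻ (bridging j) (subst (λ A → IsLift A _ _) e lj))
      ... | inj₂ (j∉rs , e) = inj₂ (j∉rs , subst (λ A → IsLift A _ _) e lj)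

      T-noncrossing : ∀ {j x y x' y'} → IsLift (T j) x' y' → IsLift (T' i) x y → ¬ SegmentsCross x' y' x y
      T-noncrossing {j} lj lᵢ c = IsTriangulation.noncrossing tri j i (SegmentsCross⇒Cross lj (lift-Tᵢ lᵢ) c)

      -- Below and to the right of a lift of d_i the staircase is blocked: a rotated arc there would cross d_i,
      -- an unrotated one would give an arrow into the source i.
      left-neighbour : ∀ {x y} → IsLift (T' i) x y → ∃[ a ] (a ≢ i × IsLift (T' a) (x - + 1) y)
      left-neighbour {x} {y} lᵢ = Sum.[ on-left , ⊥-elim ∘ not-below ]′ (left-or-below
        (NonCrossing-Lifts tri' bridging') (Saturated-Lifts tri' bridging') (Lifts? T') (i , lᵢ))
        where
          on-left : Lifts T' (x - + 1) y → ∃[ a ] (a ≢ i × IsLift (T' a) (x - + 1) y)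
          on-left (a , la) =
            a , (λ { refl → no-arrow-in i∉rs (x , y , lift-Tᵢ lᵢ , inj₂ (lift-Tᵢ la)) }) , la
          not-below : ¬ Lifts T' x (y - + 1)
          not-below (j , lj) with lift-T lj
          ... | inj₁ (_ , lj') = T-noncrossing lj' lᵢ (inj₂ (i<i+1 x , <-trans (i-1<i (y - + 1)) (i-1<i y)))
          ... | inj₂ (j∉rs , lj') = no-arrow-in j∉rs
            (x , y - + 1 , lj' , inj₁ (subst (IsLift (T i) x) (sym (i-j+j≡i y (+ 1))) (lift-Tᵢ lᵢ)))

      upper-neighbour : ∀ {x y} → IsLift (T' i) x y → ∃[ b ] (b ≢ i × IsLift (T' b) x (y + + 1))
      upper-neighbour {x} {y} lᵢ = Sum.[ ⊥-elim ∘ not-right , on-top ]′ (right-or-above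
        (NonCrossing-Lifts tri' bridging') (Saturated-Lifts tri' bridging') (Lifts? T') (i , lᵢ))
        where
          on-top : Lifts T' x (y + + 1) → ∃[ b ] (b ≢ i × IsLift (T' b) x (y + + 1))
          on-top (b , lb') =
            b , (λ { refl → no-arrow-in i∉rs (x , y , lift-Tᵢ lᵢ , inj₁ (lift-Tᵢ lb')) }) , lb'
          not-right : ¬ Lifts T' (x + + 1) y
          not-right (j , lj) with lift-T lj
          ... | inj₁ (_ , lj') = T-noncrossing lj' lᵢ (inj₂ (<-trans (i<i+1 x) (i<i+1 (x + + 1)) , i-1<i y))
          ... | inj₂ (j∉rs , lj') = no-arrow-in j∉rs
            (x + + 1 , y , lj' , inj₂ (subst (λ u → IsLift (T i) u y) (sym (i+j-j≡i x (+ 1))) (lift-Tᵢ lᵢ)))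

      corner : Corner T' i
      corner lᵢ = left-neighbour lᵢ , upper-neighbour lᵢ

    -- rs are the vertices flipped so far and rest the remaining admissible sequence; the invariant is that the
    -- flipped arcs are rotated, the others untouched, and σ has not changed the arrows among the unflipped.
    FlipsToRotation : List (Fin n) → List (Fin n) → (Fin n → Arc p q) → Set
    FlipsToRotation rs rest T' =
      (∃[ T₁ ] Flips T' rest T₁) ×
      (∀ T₁ → Flips T' rest T₁ → ∀ j → j ∈ rs ⊎ j ∈ rest → T₁ j ≡ rotate (T j))

    flips-rotate : ∀ rest rs T' Q → IsTriangulation T' → RotatedExactly rs T' → KeepsArrows rs Q →
                   AdmissibleSeq Q rest → (∀ j → j ∈ rest → j ∉ rs) → Unique rest →
                   FlipsToRotation rs rest T'
    flips-rotate [] rs T' Q _ rotated _ _ _ _ = (T' , done) , finished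
      where
        finished : ∀ T₁ → Flips T' [] T₁ → ∀ j → j ∈ rs ⊎ j ∈ [] → T₁ j ≡ rotate (T j)
        finished T₁ done j (inj₁ j∈rs) with rotated j
        ... | inj₁ (_ , e)    = e
        ... | inj₂ (j∉rs , _) = ⊥-elim (j∉rs j∈rs)
    flips-rotate (i ∷ rest) rs T' Q tri' rotated keeps (source , admissible) fresh (i∉rest ∷ unique) =
      (proj₁ (proj₁ (ih F.flip)) , step F.flip (proj₂ (proj₁ (ih F.flip)))) , all-rotated
      where
        i∉rs : i ∉ rs
        i∉rs = fresh i (here refl)

        module F = FlipAt tri' (RotatedExactly-bridging rotated) i
                          (AtSource.corner tri' rotated keeps i∉rs source)

        rotated' : ∀ {T''} → Flip T' i T'' → RotatedExactly (i ∷ rs) T''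
        rotated' f j with j Fin.≟ i
        ... | yes refl =
          inj₁ (here refl , trans (F.Flip⇒rotation f) (cong rotate (RotatedExactly-fresh rotated i∉rs)))
        ... | no j≢i with rotated j
        ...   | inj₁ (j∈rs , e) = inj₁ (there j∈rs , trans (Flip.others f j j≢i) e)
        ...   | inj₂ (j∉rs , e) =
          inj₂ ((λ { (here j≡i) → j≢i j≡i ; (there j∈rs) → j∉rs j∈rs }) ,
                trans (Flip.others f j j≢i) e)

        keeps' : KeepsArrows (i ∷ rs) (σ i Q)
        keeps' a b a∉ b∉ arrow =
          inj₂ (a∉ ∘ here , b∉ ∘ here , keeps a b (a∉ ∘ there) (b∉ ∘ there) arrow)

        fresh' : ∀ j → j ∈ rest → j ∉ i ∷ rs
        fresh' j j∈rest (here refl)  = All.lookup i∉rest j∈rest refl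
        fresh' j j∈rest (there j∈rs) = fresh j (there j∈rest) j∈rs

        ih : ∀ {T''} → Flip T' i T'' → FlipsToRotation (i ∷ rs) rest T''
        ih f = flips-rotate rest (i ∷ rs) _ (σ i Q) (Flip.triang f) (rotated' f) keeps' admissible fresh' unique

        all-rotated : ∀ T₁ → Flips T' (i ∷ rest) T₁ → ∀ j → j ∈ rs ⊎ j ∈ i ∷ rest →
                      T₁ j ≡ rotate (T j)
        all-rotated T₁ (step f flips) j j∈ = proj₂ (ih f) T₁ flips j (regroup j∈)
          where
            regroup : j ∈ rs ⊎ j ∈ i ∷ rest → j ∈ i ∷ rs ⊎ j ∈ rest
            regroup (inj₁ j∈rs)           = inj₁ (there j∈rs)
            regroup (inj₂ (here j≡i))     = inj₁ (here j≡i)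
            regroup (inj₂ (there j∈rest)) = inj₂ j∈rest

    cox≡rotation : ∀ is → Admissible (quiver T) is →
                   (∃[ T₁ ] Flips T is T₁) × (∀ T₁ → Flips T is T₁ → ∀ j → T₁ j ≡ rotate (T j))
    cox≡rotation is (ordering , admissible) =
      proj₁ result , λ T₁ flips j → proj₂ result T₁ flips j (inj₂ (ordering-complete j))
      where
        ordering-complete : ∀ j → j ∈ is
        ordering-complete j = ∈-resp-↭ (↭-sym ordering) (∈-allFin j)
        ordering-unique : Unique is
        ordering-unique = Unique-resp-↭ (setoid (Fin n)) (↭⇒↭ₛ (↭-sym ordering)) (allFin⁺ n)
        result : FlipsToRotation [] is T
        result = flips-rotate is [] T (quiver T) tri (λ j → inj₂ ((λ ()) , refl)) (λ _ _ _ _ arrow → arrow)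
                              admissible (λ _ _ ()) ordering-unique

mainTheorem3 : (p q : ℕ) → 0 ℕ.< p → 0 ℕ.< q → q ℕ.≤ p →
    (n : ℕ) (T : Fin n → Arc p q) → IsBridgingTriangulation T →
    Σ[ C ∈ (Fin n → Arc p q) ]
      ((is : List (Fin n)) → Admissible (quiver T) is →
        (Σ[ T₁ ∈ (Fin n → Arc p q) ] Flips T is T₁)
        × ((T₁ : Fin n → Arc p q) → Flips T is T₁ → SameArcs T₁ C))
mainTheorem3 p q 0<p _ _ n T (tri , bridging) = rotate ∘ T , λ is admissible →
  let cox , cox≡rotate = Coxeter.cox≡rotation tri bridging is admissible
  in cox , λ T₁ flips → (λ j → j , sym (cox≡rotate T₁ flips j)) , (λ j → j , cox≡rotate T₁ flips j)
  where
    instance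
      p≢0 : NonZero p
      p≢0 = ℕ.>-nonZero 0<p
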